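{- As a reduction pair, $\mathrm{WPO}(\mathcal A_{\mathrm{pol}})$ with the refinements (2c) and (2d) subsumes POLO: for every polynomial interpretation $\mathcal A_{\mathrm{pol}}$ there exist a quasi-precedence and a partial status $\sigma$ such that the refined WPO pair induced by $\mathcal A_{\mathrm{pol}}$ satisfies $(\succsim_{\mathrm{WPO}},\succ_{\mathrm{WPO}})=(\ge_{\mathcal A_{\mathrm{pol}}},>_{\mathcal A_{\mathrm{pol}}})$.
   Context: Terms over a finite signature $\Sigma$ and variables $\mathcal V$. A polynomial interpretation $\mathcal A_{\mathrm{pol}}$: carrier $\{a\in\mathbb N\mid a\ge w_0\}$ for some $w_0\in\mathbb N$, usual $\ge,>$, each $f\in\Sigma_n$ interpreted by a polynomial with natural coefficients (zero coefficients allowed) mapping the carrier into itself; on terms $s\ge_{\mathcal A}t$ ($>_{\mathcal A}$) iff $\hat\alpha(s)\ge\hat\alpha(t)$ ($>$) for all assignments. A partial status $\sigma$ assigns to each $f\in\Sigma_n$ a list of distinct positions in $\{1..n\}$ (also a set); $\sigma(f)(s_1..s_n)$ is the list of arguments at those positions. $\mathcal A$ is strictly simple w.r.t. $\sigma$ iff $f_{\mathcal A}(\dots,a_i,\dots)>a_i$ for all $f$, $i\in\sigma(f)$. Quasi-precedence: quasi-order $\succsim$ on $\Sigma$ with well-founded strict part $\succ$, equivalence $\sim$. Lex for a pair $(\succsim',\succ')$: $[s_1..s_n]\succsim'^{\mathrm{lex}}[t_1..t_m]$ iff there is $k\le n$ with $s_i\succsim' t_i$ ($i\le k$) and either $k=m$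 or ($k<\min(n,m)$ and $s_{k+1}\succ' t_{k+1}$); $\succ'^{\mathrm{lex}}$ likewise but with $k<n$ required when $k=m$. Refined WPO pair: $x\succsim_W x$ for variables; for $s=f(s_1..s_n)$, $s\succsim_W t$ (resp. $\succ_W$) iff (1) $s>_{\mathcal A}t$, or (2) $s\ge_{\mathcal A}t$ and (a) $s_i\succsim_W t$ for some $i\in\sigma(f)$, or (b) $t=g(t_1..t_m)$, $s\succ_W t_j$ for all $j\in\sigma(g)$, and $f\succ g$ or ($f\sim g$ and $\sigma(f)(\vec s)\succsim_W^{\mathrm{lex}}\sigma(g)(\vec t)$, resp. $\succ_W^{\mathrm{lex}}$). Additionally $s\succsim_W t$ if $s\ge_{\mathcal A}t$ and (2c) $s\in\mathcal V$, $t=g(t_1..t_m)$, $\sigma(g)=[\,]$, $f\succsim g$ for all $f$; or (2d) (only when $\mathcal A$ is strictly simple w.r.t. $\sigma$) $s=f(s_1..s_n)$, $t\in\mathcal V$, and for all $g$: $f\succ g$ or ($f\succsim g$ and $\sigma(g)=[\,]$). Nothing else is related. -}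

module Defs where

open import Data.Nat using (ℕ; _+_; _*_; _≤_; _<_)
open import Data.Fin using (Fin)
open import Data.List using (List; []; _∷_; map)
open import Data.List.Membership.Propositional using (_∈_)
open import Data.List.Relation.Unary.All using (All)
open import Data.List.Relation.Unary.Unique.Propositional using (Unique)
open import Data.Product using (Σ; _×_; ∃)
open import Data.Sum using (_⊎_)
open import Relation.Nullary using (¬_)
open import Relation.Binary.PropositionalEquality using (_≡_)
open import Relation.Binary.Structures using (IsPreorder)
open import Induction.WellFounded using (WellFounded)

-- Polynomials with natural coefficients in n variables, as expressions.
-- (Every polynomial with coefficients in ℕ, zero coefficients allowed,
--  is denoted by such an expression, and every expression denotes one.)

data Poly (n : ℕ) : Set where
  con  : ℕ → Poly n
  pvar : Fin n → Poly n
  _⊕_  : Poly n → Poly n → Poly n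
  _⊗_  : Poly n → Poly n → Poly n

evalP : ∀ {n} → Poly n → (Fin n → ℕ) → ℕ
evalP (con c)  a = c
evalP (pvar i) a = a i
evalP (p ⊕ q)  a = evalP p a + evalP q a
evalP (p ⊗ q)  a = evalP p a * evalP q a

data Term {k : ℕ} (ar : Fin k → ℕ) : Set where
  var : ℕ → Term ar
  fun : (f : Fin k) → (Fin (ar f) → Term ar) → Term ar

InCarrier : ℕ → ∀ {n} → (Fin n → ℕ) → Set
InCarrier w₀ a = ∀ i → w₀ ≤ a i

record PolyInterp {k : ℕ} (ar : Fin k → ℕ) : Set where
  field
    w₀     : ℕ
    interp : (f : Fin k) → Poly (ar f)
    closed : ∀ f (a : Fin (ar f) → ℕ) → InCarrier w₀ a → w₀ ≤ evalP (interp f) a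

module _ {k : ℕ} {ar : Fin k → ℕ} (A : PolyInterp ar) where
  open PolyInterp A

  ⟦_⟧ : Term ar → (ℕ → ℕ) → ℕ
  ⟦ var x ⟧    α = α x
  ⟦ fun f ts ⟧ α = evalP (interp f) (λ i → ⟦ ts i ⟧ α)

  Assignment : (ℕ → ℕ) → Set
  Assignment α = ∀ x → w₀ ≤ α x

  _≥A_ : Term ar → Term ar → Set
  s ≥A t = ∀ α → Assignment α → ⟦ t ⟧ α ≤ ⟦ s ⟧ α

  _>A_ : Term ar → Term ar → Set
  s >A t = ∀ α → Assignment α → ⟦ t ⟧ α < ⟦ s ⟧ α

record PartialStatus {k : ℕ} (ar : Fin k → ℕ) : Set where
  field
    pos      : (f : Fin k) → List (Fin (ar f))
    distinct : ∀ f → Unique (pos f)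

StrictlySimple : ∀ {k} {ar : Fin k → ℕ} → PolyInterp ar → PartialStatus ar → Set
StrictlySimple {k} {ar} A σ =
  ∀ (f : Fin k) (i : Fin (ar f)) → i ∈ PartialStatus.pos σ f →
  ∀ (a : Fin (ar f) → ℕ) → InCarrier (PolyInterp.w₀ A) a →
  a i < evalP (PolyInterp.interp A f) a

record QuasiPrecedence (k : ℕ) : Set₁ where
  field
    _≿_        : Fin k → Fin k → Set
    isPreorder : IsPreorder _≡_ _≿_

  _≻_ : Fin k → Fin k → Set
  f ≻ g = f ≿ g × ¬ (g ≿ f)

  _∼_ : Fin k → Fin k → Set
  f ∼ g = f ≿ g × g ≿ f

  field
    wf : WellFounded _≻_

-- The refined WPO pair.  Mode ns gives ≿_WPO, mode st gives ≻_WPO.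

data Mode : Set where
  ns st : Mode

module WPO {k : ℕ} {ar : Fin k → ℕ} (A : PolyInterp ar)
           (P : QuasiPrecedence k) (σ : PartialStatus ar) where
  open QuasiPrecedence P
  open PartialStatus σ

  args : (f : Fin k) → (Fin (ar f) → Term ar) → List (Term ar)
  args f ss = map ss (pos f)

  mutual
    data W : Mode → Term ar → Term ar → Set where
      refl-var : ∀ x → W ns (var x) (var x)
      gt   : ∀ {m f ss t} → _>A_ A (fun f ss) t → W m (fun f ss) t
      sub  : ∀ {m f ss t i} → _≥A_ A (fun f ss) t →
             i ∈ pos f → W ns (ss i) t → W m (fun f ss) t
      prec : ∀ {m f ss g ts} → _≥A_ A (fun f ss) (fun g ts) →
             All (λ j → W st (fun f ss) (ts j)) (pos g) →
             f ≻ g → W m (fun f ss) (fun g ts)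
      lex  : ∀ {m f ss g ts} → _≥A_ A (fun f ss) (fun g ts) →
             All (λ j → W st (fun f ss) (ts j)) (pos g) →
             f ∼ g → Lex m (args f ss) (args g ts) → W m (fun f ss) (fun g ts)
      var-min : ∀ {x g ts} → _≥A_ A (var x) (fun g ts) →
                pos g ≡ [] → (∀ f → f ≿ g) → W ns (var x) (fun g ts)
      fun-var : ∀ {f ss x} → StrictlySimple A σ → _≥A_ A (fun f ss) (var x) →
                (∀ g → f ≻ g ⊎ (f ≿ g × pos g ≡ [])) → W ns (fun f ss) (var x)

    -- Lexicographic extension of (W ns, W st), in mode m;
    -- structural unfolding of the k-based definition.
    data Lex : Mode → List (Term ar) → List (Term ar) → Set where
      lex-nil    : Lex ns [] []
      lex-end    : ∀ {m s ss} → Lex m (s ∷ ss) []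
      lex-strict : ∀ {m s ss t ts} → W st s t → Lex m (s ∷ ss) (t ∷ ts)
      lex-cons   : ∀ {m s ss t ts} → W ns s t → Lex m ss ts → Lex m (s ∷ ss) (t ∷ ts)

  _≿W_ : Term ar → Term ar → Set
  s ≿W t = W ns s t

  _≻W_ : Term ar → Term ar → Set
  s ≻W t = W st s t

-- Take the precedence in which all symbols are equivalent and the empty status.
-- Then every WPO rule other than (1) needs only s ≥_A t, and each shape of
-- s ≥_A t is covered by one of them: (2b) with the empty lexicographic
-- comparison for two function terms, (2c) and (2d) for variable/function pairs,
-- and reflexivity for two variables, since x ≥_A y forces x = y.  Strict steps
-- other than (1) are impossible, and a variable is never >_A a term because
-- every term evaluates into the carrier.
module Submission where

open import Defs
open import Data.Nat using (ℕ; _+_; _∸_; _≤_)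
open import Data.Nat.Properties
  using (≤-refl; ≤-trans; ≤-reflexive; ≤-antisym; <⇒≤; <⇒≱; +-cancelˡ-≤; m≤m+n;
         n∸n≡0; n≤0⇒n≡0; m∸n≡0⇒m≤n)
open import Data.Fin using (Fin)
open import Data.Product using (Σ; _×_; _,_)
open import Data.Sum using (inj₂)
open import Data.Unit using (⊤; tt)
open import Data.Empty using (⊥-elim)
open import Data.List using ([])
open import Data.List.Relation.Unary.All using ([])
import Data.List.Relation.Unary.Unique.Propositional as Unique
open import Relation.Nullary using (¬_)
open import Relation.Binary.PropositionalEquality using (_≡_; refl; isEquivalence)
open import Induction.WellFounded using (acc)
open import Function.Bundles using (_⇔_; mk⇔)

indiscrete : ∀ {k} → QuasiPrecedence k
indiscrete = record
  { _≿_        = λ _ _ → ⊤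
  ; isPreorder = record
    { isEquivalence = isEquivalence ; reflexive = λ _ → tt ; trans = λ _ _ → tt }
  ; wf         = λ _ → acc λ { (_ , g⋡f) → ⊥-elim (g⋡f tt) }
  }

emptyStatus : ∀ {k} {ar : Fin k → ℕ} → PartialStatus ar
emptyStatus = record { pos = λ _ → [] ; distinct = λ _ → Unique.[] }

emptyStatus-strictlySimple : ∀ {k} {ar : Fin k → ℕ} (A : PolyInterp ar) →
                             StrictlySimple A emptyStatus
emptyStatus-strictlySimple A f i ()

module _ {k : ℕ} {ar : Fin k → ℕ} (A : PolyInterp ar) where
  open PolyInterp A

  ⟦⟧-inCarrier : ∀ t {α} → Assignment A α → w₀ ≤ ⟦ A ⟧ t α
  ⟦⟧-inCarrier (var x)    α∈ = α∈ x
  ⟦⟧-inCarrier (fun f ts) α∈ = closed f _ (λ i → ⟦⟧-inCarrier (ts i) α∈)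

  var-≯A : ∀ x t → ¬ _>A_ A (var x) t
  var-≯A x t x>t = <⇒≱ (x>t (λ _ → w₀) (λ _ → ≤-refl)) (⟦⟧-inCarrier t (λ _ → ≤-refl))

  -- The assignments z ↦ w₀ + z and z ↦ w₀ + (x ∸ z) give y ≤ x and x ∸ y ≤ 0.
  var-≥A-var⇒≡ : ∀ {x y} → _≥A_ A (var x) (var y) → x ≡ y
  var-≥A-var⇒≡ {x} {y} x≥y = ≤-antisym x≤y y≤x
    where
    y≤x : y ≤ x
    y≤x = +-cancelˡ-≤ w₀ y x (x≥y (λ z → w₀ + z) (λ z → m≤m+n w₀ z))

    x∸y≤0 : x ∸ y ≤ 0
    x∸y≤0 = ≤-trans
      (+-cancelˡ-≤ w₀ (x ∸ y) (x ∸ x) (x≥y (λ z → w₀ + (x ∸ z)) (λ z → m≤m+n w₀ (x ∸ z))))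
      (≤-reflexive (n∸n≡0 x))

    x≤y : x ≤ y
    x≤y = m∸n≡0⇒m≤n (n≤0⇒n≡0 x∸y≤0)

  module _ (P : QuasiPrecedence k) (σ : PartialStatus ar) where
    open WPO A P σ

    W⇒≥A : ∀ {m s t} → W m s t → _≥A_ A s t
    W⇒≥A (refl-var x)      α α∈ = ≤-refl
    W⇒≥A (gt s>t)          α α∈ = <⇒≤ (s>t α α∈)
    W⇒≥A (sub s≥t _ _)     = s≥t
    W⇒≥A (prec s≥t _ _)    = s≥t
    W⇒≥A (lex s≥t _ _ _)   = s≥t
    W⇒≥A (var-min s≥t _ _) = s≥t
    W⇒≥A (fun-var _ s≥t _) = s≥t

  module _ (P : QuasiPrecedence k) (all-related : ∀ f g → QuasiPrecedence._≿_ P f g) where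
    open QuasiPrecedence P using (_≻_)
    open WPO A P emptyStatus

    ≻-empty : ∀ {f g} → ¬ f ≻ g
    ≻-empty {f} {g} (_ , g⋡f) = g⋡f (all-related g f)

    ≻W⇒>A : ∀ {s t} → s ≻W t → _>A_ A s t
    ≻W⇒>A (gt s>t)          = s>t
    ≻W⇒>A (sub _ () _)
    ≻W⇒>A (prec _ _ f≻g)    = ⊥-elim (≻-empty f≻g)
    ≻W⇒>A (lex _ _ _ ())

    ≥A⇒≿W : ∀ s t → _≥A_ A s t → s ≿W t
    ≥A⇒≿W (var x)    (var y)    x≥y with refl ← var-≥A-var⇒≡ x≥y = refl-var x
    ≥A⇒≿W (var x)    (fun g ts) x≥t = var-min x≥t refl (λ f → all-related f g)
    ≥A⇒≿W (fun f ss) (var x)    s≥x =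
      fun-var (emptyStatus-strictlySimple A) s≥x (λ g → inj₂ (all-related f g , refl))
    ≥A⇒≿W (fun f ss) (fun g ts) s≥t =
      lex s≥t [] (all-related f g , all-related g f) lex-nil

    >A⇒≻W : ∀ s t → _>A_ A s t → s ≻W t
    >A⇒≻W (var x)    t x>t = ⊥-elim (var-≯A x t x>t)
    >A⇒≻W (fun f ss) t s>t = gt s>t

corollary5 : ∀ {k : ℕ} (ar : Fin k → ℕ) (A : PolyInterp ar) →
    Σ (QuasiPrecedence k) λ P → Σ (PartialStatus ar) λ σ →
      (∀ s t → (WPO._≿W_ A P σ s t ⇔ _≥A_ A s t)) ×
      (∀ s t → (WPO._≻W_ A P σ s t ⇔ _>A_ A s t))
corollary5 ar A =
  indiscrete , emptyStatus ,
  (λ s t → mk⇔ (W⇒≥A A indiscrete emptyStatus) (≥A⇒≿W A indiscrete all-related s t)) ,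
  (λ s t → mk⇔ (≻W⇒>A A indiscrete all-related) (>A⇒≻W A indiscrete all-related s t))
  where
  all-related : ∀ f g → QuasiPrecedence._≿_ indiscrete f g
  all-related _ _ = tt
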